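{- Let $T=S_{\ell_1,\ell_2}$ be a double star of order $n$ with centers $c_1,c_2$, where $c_i$ has $\ell_i\ge 1$ leaves for $i=1,2$ (so $n=\ell_1+\ell_2+2$). Then $\Delta_T=\lceil n/2\rceil$ if $\ell_1$ and $\ell_2$ are both odd, and $\Delta_T=\lceil n/2\rceil-1$ otherwise.
   Context: The double star $S_{a,b}$ ($a,b\ge1$) is the tree obtained from an edge $c_1c_2$ by attaching $a$ leaves to $c_1$ and $b$ leaves to $c_2$. A $\Delta$-completion set of a graph $G$ is a set $F$ of non-edges of $G$ such that every vertex of $G+F$ lies in a triangle; $\Delta_G$ is the minimum size of such a set. -}

module Defs where

open import Data.Nat using (ℕ; zero; suc; _+_; _≤_; _<_; ⌈_/2⌉)
open import Data.Fin using (Fin; toℕ)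
open import Data.Product using (Σ; ∃; _×_; _,_)
open import Data.Sum using (_⊎_)
open import Data.List using (List; length)
open import Data.List.Membership.Propositional using (_∈_)
open import Data.List.Relation.Unary.All using (All)
open import Data.List.Relation.Unary.Unique.Propositional using (Unique)
open import Relation.Nullary using (¬_)
open import Relation.Binary.PropositionalEquality using (_≡_)

Graph : ℕ → Set₁
Graph n = Fin n → Fin n → Set

-- A set of non-edges of G, represented as a duplicate-free list of pairs (u , v)
-- with toℕ u < toℕ v (so each unordered pair is represented exactly once and
-- the length of the list is the size of the set), none of which is an edge of G.
IsNonEdgeSet : {n : ℕ} → Graph n → List (Fin n × Fin n) → Set
IsNonEdgeSet G F =
  Unique F × All (λ { (u , v) → (toℕ u < toℕ v) × ¬ G u v }) F

_⊕_ : {n : ℕ} → Graph n → List (Fin n × Fin n) → Graph n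
(G ⊕ F) u v = G u v ⊎ ((u , v) ∈ F ⊎ (v , u) ∈ F)

InTriangle : {n : ℕ} → Graph n → Fin n → Set
InTriangle H v = ∃ λ u → ∃ λ w → H v u × H u w × H v w

IsΔCompletion : {n : ℕ} → Graph n → List (Fin n × Fin n) → Set
IsΔCompletion {n} G F = IsNonEdgeSet G F × ((v : Fin n) → InTriangle (G ⊕ F) v)

IsΔ : {n : ℕ} → Graph n → ℕ → Set
IsΔ G k =
  (Σ _ λ F → IsΔCompletion G F × length F ≡ k)
  × (∀ F → IsΔCompletion G F → k ≤ length F)

-- The double star S_{ℓ₁,ℓ₂} on vertex set Fin (ℓ₁ + ℓ₂ + 2):
-- vertex 0 is c₁, vertex 1 is c₂, vertices 2 .. ℓ₁+1 are the leaves of c₁,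
-- vertices ℓ₁+2 .. ℓ₁+ℓ₂+1 are the leaves of c₂.
data DSEdge (ℓ₁ : ℕ) : ℕ → ℕ → Set where
  centres : DSEdge ℓ₁ 0 1
  leaf₁   : {i : ℕ} → 2 ≤ i → i < 2 + ℓ₁ → DSEdge ℓ₁ 0 i
  leaf₂   : {i : ℕ} → 2 + ℓ₁ ≤ i → DSEdge ℓ₁ 1 i

DoubleStar : (ℓ₁ ℓ₂ : ℕ) → Graph (ℓ₁ + ℓ₂ + 2)
DoubleStar ℓ₁ ℓ₂ u v = DSEdge ℓ₁ (toℕ u) (toℕ v) ⊎ DSEdge ℓ₁ (toℕ v) (toℕ u)

module Submission where

-- A leaf lies in a triangle of T + F only if it is an endpoint of a pair of F, since its
-- only neighbour in T is its centre; counting endpoints gives ℓ₁ + ℓ₂ ≤ 2|F|.  When ℓ₁ is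
-- odd the inequality is strict: either a centre is an endpoint, or a pair joins a leaf x of
-- c₁ to a leaf y of c₂ and x needs a second pair (c₁ and y are not adjacent), or else the
-- pairs meeting the leaves of c₁ lie inside them and these leaves have an even number of
-- endpoint occurrences.  Conversely, pairing consecutive leaves of each centre and joining
-- a leftover leaf to the other centre gives a completion of size ⌈ℓ₁/2⌉ + ⌈ℓ₂/2⌉.

open import Defs
open import Data.Nat using (ℕ; zero; suc; _+_; _∸_; _≤_; _<_; _≟_; _≤?_; _<?_; _%_; ⌈_/2⌉; z≤n; s≤s; z<s)
open import Data.Nat.Properties
open import Data.Nat.Divisibility using (_∣_; ∣-refl; ∣m∣n⇒∣m+n; _∣0; n∣m⇒m%n≡0)
open import Data.Nat.Tactic.RingSolver using (solve-∀)
open import Data.Fin using (Fin; toℕ; fromℕ<; punchIn)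
open import Data.Fin.Properties
  using (injective⇒≤; punchIn-injective; punchInᵢ≢i; toℕ-fromℕ<; toℕ-injective; toℕ<n)
open import Data.Product using (Σ; ∃; _×_; _,_; proj₁; proj₂)
import Data.Product as Product
open import Data.Sum using (_⊎_; inj₁; inj₂; [_,_]′)
import Data.Sum as Sum
open import Data.Unit using (tt)
open import Data.Empty using (⊥-elim)
open import Data.List using (List; []; _∷_; _++_; length; filter; lookup)
open import Data.List.Properties using (filter-++; length-++; filter-some; length-filter)
open import Data.List.Membership.Propositional using (_∈_; find; lose)
open import Data.List.Membership.Propositional.Properties using (∈-filter⁺; ∈-++⁺ˡ; ∈-++⁺ʳ)
open import Data.List.Relation.Unary.Any as Any using (Any; here; there; index; any?)
open import Data.List.Relation.Unary.Any.Properties using (lookup-index)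
open import Data.List.Relation.Unary.All as All using (All; []; _∷_)
import Data.List.Relation.Unary.All.Properties as All
open import Data.List.Relation.Unary.AllPairs using ([]; _∷_)
open import Data.List.Relation.Unary.Unique.Propositional using (Unique)
import Data.List.Relation.Unary.Unique.Propositional.Properties as Unique
open import Data.List.Relation.Binary.Disjoint.Propositional using (Disjoint)
open import Function using (_∘_)
open import Function.Definitions using (Injective)
open import Relation.Nullary using (¬_; yes; no; ¬?)
open import Relation.Nullary.Decidable using (_×-dec_; _⊎-dec_)
open import Relation.Unary using (Pred; Decidable; _⊆_)
open import Relation.Binary.Definitions using (Symmetric; DecidableEquality)
open import Relation.Binary.PropositionalEquality

module _ {a} {A : Set a} where

  count : ∀ {p} {P : Pred A p} → Decidable P → List A → ℕ
  count P? xs = length (filter P? xs)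

  count-++ : ∀ {p} {P : Pred A p} (P? : Decidable P) xs ys →
             count P? (xs ++ ys) ≡ count P? xs + count P? ys
  count-++ P? xs ys = trans (cong length (filter-++ P? xs ys)) (length-++ (filter P? xs))

  count-+-≤ : ∀ {p q r} {P : Pred A p} {Q : Pred A q} {R : Pred A r}
              (P? : Decidable P) (Q? : Decidable Q) (R? : Decidable R) →
              (∀ {x} → P x → ¬ Q x) → P ⊆ R → Q ⊆ R →
              ∀ xs → count P? xs + count Q? xs ≤ count R? xs
  count-+-≤ P? Q? R? disjoint P⊆R Q⊆R [] = z≤n
  count-+-≤ P? Q? R? disjoint P⊆R Q⊆R (x ∷ xs)
    with ih ← count-+-≤ P? Q? R? disjoint P⊆R Q⊆R xs | P? x | Q? x | R? x
  ... | yes px | yes qx | _      = ⊥-elim (disjoint px qx)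
  ... | yes px | no _   | no ¬rx = ⊥-elim (¬rx (P⊆R px))
  ... | no _   | yes qx | no ¬rx = ⊥-elim (¬rx (Q⊆R qx))
  ... | yes _  | no _   | yes _  = s≤s ih
  ... | no _   | yes _  | yes _  = subst (_≤ suc (count R? xs)) (sym (+-suc _ _)) (s≤s ih)
  ... | no _   | no _   | yes _  = m≤n⇒m≤1+n ih
  ... | no _   | no _   | no _   = ih

  -- Pigeonhole on the positions in filter P? xs of the values of f.
  injective⇒≤count : ∀ {p m} {P : Pred A p} (P? : Decidable P) {xs} (f : Fin m → A) →
                     Injective _≡_ _≡_ f → (∀ i → f i ∈ xs) → (∀ i → P (f i)) →
                     m ≤ count P? xs
  injective⇒≤count P? {xs} f f-inj f∈xs Pf = injective⇒≤ position-injective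
    where
    position : ∀ i → f i ∈ filter P? xs
    position i = ∈-filter⁺ P? (f∈xs i) (Pf i)

    position-injective : Injective _≡_ _≡_ (λ i → index (position i))
    position-injective {i} {j} eq = f-inj (begin
      f i                                         ≡⟨ lookup-index (position i) ⟩
      lookup (filter P? xs) (index (position i))  ≡⟨ cong (lookup (filter P? xs)) eq ⟩
      lookup (filter P? xs) (index (position j))  ≡⟨ lookup-index (position j) ⟨
      f j                                         ∎)
      where open ≡-Reasoning

  module Occurrences (_≟_ : DecidableEquality A) where

    occurrences : A → List A → ℕ
    occurrences x = count (_≟ x)

    occurrences-≥1 : ∀ {x xs} → x ∈ xs → 1 ≤ occurrences x xs
    occurrences-≥1 x∈xs = filter-some (_≟ _) (Any.map sym x∈xs)

    injective∧repeated⇒<count : ∀ {p m} {P : Pred A p} (P? : Decidable P) {xs} (f : Fin m → A) →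
                                Injective _≡_ _≡_ f → (∀ i → f i ∈ xs) → (∀ i → P (f i)) →
                                ∀ i → 2 ≤ occurrences (f i) xs → m < count P? xs
    injective∧repeated⇒<count {m = suc m} {P} P? {xs} f f-inj f∈xs Pf i twice = begin
      2 + m                                    ≡⟨ +-comm 2 m ⟩
      m + 2                                    ≤⟨ +-mono-≤ others-≥ twice ⟩
      count others? xs + occurrences (f i) xs  ≤⟨ count-+-≤ others? (_≟ f i) P?
                                                    proj₂ proj₁ (λ { refl → Pf i }) xs ⟩
      count P? xs                              ∎
      where
      open ≤-Reasoning
      others? : Decidable (λ x → P x × x ≢ f i)
      others? x = P? x ×-dec ¬? (x ≟ f i)
      others-≥ : m ≤ count others? xs
      others-≥ = injective⇒≤count others? (f ∘ punchIn i)
        (punchIn-injective i _ _ ∘ f-inj) (f∈xs ∘ punchIn i)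
        (λ j → Pf (punchIn i j) , punchInᵢ≢i i j ∘ f-inj)

module _ {n : ℕ} where

  Linked : List (Fin n × Fin n) → Fin n → Fin n → Set
  Linked F u v = (u , v) ∈ F ⊎ (v , u) ∈ F

  ends : Fin n × Fin n → List ℕ
  ends (u , v) = toℕ u ∷ toℕ v ∷ []

  endpoints : List (Fin n × Fin n) → List ℕ
  endpoints []      = []
  endpoints (p ∷ F) = ends p ++ endpoints F

  length-endpoints : ∀ F → length (endpoints F) ≡ length F + length F
  length-endpoints []      = refl
  length-endpoints (p ∷ F) = cong suc (trans (cong suc (length-endpoints F)) (sym (+-suc _ _)))

  ∈-endpoints : ∀ {p F k} → p ∈ F → k ∈ ends p → k ∈ endpoints F
  ∈-endpoints {F = q ∷ F} (here refl) k∈p = ∈-++⁺ˡ k∈p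
  ∈-endpoints {F = q ∷ F} (there p∈F) k∈p = ∈-++⁺ʳ (ends q) (∈-endpoints p∈F k∈p)

  linked-endpoint : ∀ {F u v} → Linked F u v → toℕ u ∈ endpoints F
  linked-endpoint (inj₁ uv∈F) = ∈-endpoints uv∈F (here refl)
  linked-endpoint (inj₂ vu∈F) = ∈-endpoints vu∈F (there (here refl))

  open Occurrences _≟_

  endpoint-pair-unique : ∀ {F p q k} → occurrences k (endpoints F) ≤ 1 →
                         p ∈ F → q ∈ F → k ∈ ends p → k ∈ ends q → p ≡ q
  endpoint-pair-unique {r ∷ F} {k = k} once = unique
    where
    once′ : occurrences k (ends r) + occurrences k (endpoints F) ≤ 1
    once′ = subst (_≤ 1) (count-++ (_≟ k) (ends r) (endpoints F)) once

    not-twice : k ∈ ends r → ¬ k ∈ endpoints F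
    not-twice k∈r k∈F = <⇒≱ (+-mono-≤ (occurrences-≥1 k∈r) (occurrences-≥1 k∈F)) once′

    unique : ∀ {p q} → p ∈ r ∷ F → q ∈ r ∷ F → k ∈ ends p → k ∈ ends q → p ≡ q
    unique (here refl)  (here refl)  _   _   = refl
    unique (here refl)  (there q∈F) k∈p k∈q = ⊥-elim (not-twice k∈p (∈-endpoints q∈F k∈q))
    unique (there p∈F) (here refl)  k∈p k∈q = ⊥-elim (not-twice k∈q (∈-endpoints p∈F k∈p))
    unique (there p∈F) (there q∈F) k∈p k∈q =
      endpoint-pair-unique (m+n≤o⇒n≤o (occurrences k (ends r)) once′) p∈F q∈F k∈p k∈q

  linked-unique : ∀ {F x y z} → occurrences (toℕ x) (endpoints F) ≤ 1 →
                  Linked F x y → Linked F x z → y ≡ z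
  linked-unique once (inj₁ xy) (inj₁ xz) =
    cong proj₂ (endpoint-pair-unique once xy xz (here refl) (here refl))
  linked-unique once (inj₁ xy) (inj₂ zx) =
    let e = endpoint-pair-unique once xy zx (here refl) (there (here refl))
    in trans (cong proj₂ e) (cong proj₁ e)
  linked-unique once (inj₂ yx) (inj₁ xz) =
    let e = endpoint-pair-unique once yx xz (there (here refl)) (here refl)
    in trans (cong proj₁ e) (cong proj₂ e)
  linked-unique once (inj₂ yx) (inj₂ zx) =
    cong proj₁ (endpoint-pair-unique once yx zx (there (here refl)) (there (here refl)))

  Straddles : ∀ {p} → Pred ℕ p → Pred (Fin n × Fin n) p
  Straddles P (u , v) = (P (toℕ u) × ¬ P (toℕ v)) ⊎ (¬ P (toℕ u) × P (toℕ v))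

  straddles? : ∀ {p} {P : Pred ℕ p} → Decidable P → Decidable (Straddles P)
  straddles? P? (u , v) =
    (P? (toℕ u) ×-dec ¬? (P? (toℕ v))) ⊎-dec (¬? (P? (toℕ u)) ×-dec P? (toℕ v))

  even-count-endpoints : ∀ {p} {P : Pred ℕ p} (P? : Decidable P) {F} →
                         All (¬_ ∘ Straddles P) F → 2 ∣ count P? (endpoints F)
  even-count-endpoints P? [] = 2 ∣0
  even-count-endpoints P? {(u , v) ∷ F} (¬s ∷ ¬ss) with P? (toℕ u)
  ... | yes pu with P? (toℕ v)
  ...   | yes _  = ∣m∣n⇒∣m+n ∣-refl (even-count-endpoints P? ¬ss)
  ...   | no ¬pv = ⊥-elim (¬s (inj₁ (pu , ¬pv)))
  even-count-endpoints P? {(u , v) ∷ F} (¬s ∷ ¬ss) | no ¬pu with P? (toℕ v)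
  ...   | yes pv = ⊥-elim (¬s (inj₂ (¬pu , pv)))
  ...   | no _   = even-count-endpoints P? ¬ss

⊕-sym : ∀ {n} {G : Graph n} {F} → Symmetric G → Symmetric (G ⊕ F)
⊕-sym G-sym = Sum.map G-sym Sum.swap

DoubleStar-sym : ∀ {ℓ₁ ℓ₂} → Symmetric (DoubleStar ℓ₁ ℓ₂)
DoubleStar-sym = Sum.swap

2+ℓ₁+ℓ₂≡N : ∀ ℓ₁ ℓ₂ → 2 + ℓ₁ + ℓ₂ ≡ ℓ₁ + ℓ₂ + 2
2+ℓ₁+ℓ₂≡N ℓ₁ ℓ₂ = trans (+-assoc 2 ℓ₁ ℓ₂) (+-comm 2 (ℓ₁ + ℓ₂))

2+ℓ₁≤N : ∀ ℓ₁ ℓ₂ → 2 + ℓ₁ ≤ ℓ₁ + ℓ₂ + 2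
2+ℓ₁≤N ℓ₁ ℓ₂ = ≤-trans (m≤m+n (2 + ℓ₁) ℓ₂) (≤-reflexive (2+ℓ₁+ℓ₂≡N ℓ₁ ℓ₂))

module _ {ℓ : ℕ} where

  DSEdge-< : ∀ {i j} → DSEdge ℓ i j → i < j
  DSEdge-< centres       = s≤s z≤n
  DSEdge-< (leaf₁ 2≤j _) = ≤-trans (s≤s z≤n) 2≤j
  DSEdge-< (leaf₂ 2+ℓ≤j) = ≤-trans (s≤s (s≤s z≤n)) (≤-trans (m≤m+n 2 ℓ) 2+ℓ≤j)

  DSEdge-from-centre : ∀ {i j} → DSEdge ℓ i j → i < 2
  DSEdge-from-centre centres     = s≤s z≤n
  DSEdge-from-centre (leaf₁ _ _) = s≤s z≤n
  DSEdge-from-centre (leaf₂ _)   = s≤s (s≤s z≤n)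

  DSEdge-centre-unique : ∀ {i j k} → DSEdge ℓ i k → DSEdge ℓ j k → i ≡ j
  DSEdge-centre-unique centres            centres            = refl
  DSEdge-centre-unique (leaf₁ _ _)        (leaf₁ _ _)        = refl
  DSEdge-centre-unique (leaf₂ _)          (leaf₂ _)          = refl
  DSEdge-centre-unique centres            (leaf₁ (s≤s ()) _)
  DSEdge-centre-unique centres            (leaf₂ (s≤s ()))
  DSEdge-centre-unique (leaf₁ (s≤s ()) _) centres
  DSEdge-centre-unique (leaf₂ (s≤s ()))   centres
  DSEdge-centre-unique (leaf₁ _ k<2+ℓ)    (leaf₂ 2+ℓ≤k)      = ⊥-elim (<⇒≱ k<2+ℓ 2+ℓ≤k)
  DSEdge-centre-unique (leaf₂ 2+ℓ≤k)      (leaf₁ _ k<2+ℓ)    = ⊥-elim (<⇒≱ k<2+ℓ 2+ℓ≤k)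

  DSEdge-0-< : ∀ {j} → DSEdge ℓ 0 j → j < 2 + ℓ
  DSEdge-0-< centres          = s≤s (s≤s z≤n)
  DSEdge-0-< (leaf₁ _ j<2+ℓ) = j<2+ℓ

module LowerBound {ℓ₁ ℓ₂ : ℕ} {F : List (Fin (ℓ₁ + ℓ₂ + 2) × Fin (ℓ₁ + ℓ₂ + 2))}
                  (completion : IsΔCompletion (DoubleStar ℓ₁ ℓ₂) F) where

  N : ℕ
  N = ℓ₁ + ℓ₂ + 2

  H : Graph N
  H = DoubleStar ℓ₁ ℓ₂ ⊕ F

  E : List ℕ
  E = endpoints F

  open Occurrences _≟_

  H-sym : Symmetric H
  H-sym = ⊕-sym DoubleStar-sym

  H-irrefl : ∀ {u w} → H u w → toℕ u ≢ toℕ w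
  H-irrefl (inj₁ (inj₁ e))  = <⇒≢ (DSEdge-< e)
  H-irrefl (inj₁ (inj₂ e))  = >⇒≢ (DSEdge-< e)
  H-irrefl (inj₂ (inj₁ uw)) = <⇒≢ (proj₁ (All.lookup (proj₂ (proj₁ completion)) uw))
  H-irrefl (inj₂ (inj₂ wu)) = >⇒≢ (proj₁ (All.lookup (proj₂ (proj₁ completion)) wu))

  leaf-neighbour : ∀ {v z} → 2 ≤ toℕ v → H v z → DSEdge ℓ₁ (toℕ z) (toℕ v) ⊎ Linked F v z
  leaf-neighbour 2≤v (inj₁ (inj₁ e)) = ⊥-elim (<⇒≱ (DSEdge-from-centre e) 2≤v)
  leaf-neighbour 2≤v (inj₁ (inj₂ e)) = inj₁ e
  leaf-neighbour 2≤v (inj₂ l)        = inj₂ l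

  leaf-linked : ∀ {v} → 2 ≤ toℕ v → ∃ (Linked F v)
  leaf-linked {v} 2≤v with proj₂ completion v
  ... | u , w , vu , uw , vw with leaf-neighbour 2≤v vu | leaf-neighbour 2≤v vw
  ...   | inj₂ l | _       = u , l
  ...   | inj₁ _ | inj₂ l  = w , l
  ...   | inj₁ e | inj₁ e′ = ⊥-elim (H-irrefl uw (DSEdge-centre-unique e e′))

  leaf-endpoint : ∀ {x} → 2 ≤ x → x < N → x ∈ E
  leaf-endpoint {x} 2≤x x<N = subst (_∈ E) (toℕ-fromℕ< x<N)
    (linked-endpoint (proj₂ (leaf-linked (subst (2 ≤_) (sym (toℕ-fromℕ< x<N)) 2≤x))))

  InA : Pred ℕ _
  InA x = 2 ≤ x × x < 2 + ℓ₁

  InA? : Decidable InA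
  InA? x = 2 ≤? x ×-dec x <? 2 + ℓ₁

  NotA? : Decidable (¬_ ∘ InA)
  NotA? = ¬? ∘ InA?

  aLeaf : Fin ℓ₁ → ℕ
  aLeaf i = 2 + toℕ i

  aLeaf-InA : ∀ i → InA (aLeaf i)
  aLeaf-InA i = m≤m+n 2 _ , +-monoʳ-< 2 (toℕ<n i)

  aLeaf-injective : Injective _≡_ _≡_ aLeaf
  aLeaf-injective = toℕ-injective ∘ +-cancelˡ-≡ 2 _ _

  aLeaf∈E : ∀ i → aLeaf i ∈ E
  aLeaf∈E i = leaf-endpoint (m≤m+n 2 _) (<-≤-trans (proj₂ (aLeaf-InA i)) (2+ℓ₁≤N ℓ₁ ℓ₂))

  ℓ₁≤count-A : ℓ₁ ≤ count InA? E
  ℓ₁≤count-A = injective⇒≤count InA? aLeaf aLeaf-injective aLeaf∈E aLeaf-InA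

  repeated⇒ℓ₁<count-A : ∀ {x} → InA x → 2 ≤ occurrences x E → ℓ₁ < count InA? E
  repeated⇒ℓ₁<count-A (s≤s (s≤s z≤n) , x<2+ℓ₁) twice =
    injective∧repeated⇒<count InA? aLeaf aLeaf-injective aLeaf∈E aLeaf-InA (fromℕ< k<ℓ₁)
      (subst (λ x → 2 ≤ occurrences x E) (cong (2 +_) (sym (toℕ-fromℕ< k<ℓ₁))) twice)
    where
    k<ℓ₁ : _ < ℓ₁
    k<ℓ₁ = ≤-pred (≤-pred x<2+ℓ₁)

  count-centres+ℓ₂≤count-notA : count (_<? 2) E + ℓ₂ ≤ count NotA? E
  count-centres+ℓ₂≤count-notA = ≤-trans (+-monoʳ-≤ (count (_<? 2) E) ℓ₂≤count-B)
    (count-+-≤ (_<? 2) InB? NotA? (λ x<2 2+ℓ₁≤x → <⇒≱ x<2 (≤-trans (m≤m+n 2 ℓ₁) 2+ℓ₁≤x))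
      (λ x<2 (2≤x , _) → <⇒≱ x<2 2≤x) (λ 2+ℓ₁≤x (_ , x<2+ℓ₁) → <⇒≱ x<2+ℓ₁ 2+ℓ₁≤x) E)
    where
    InB? : Decidable (2 + ℓ₁ ≤_)
    InB? = 2 + ℓ₁ ≤?_

    bLeaf : Fin ℓ₂ → ℕ
    bLeaf j = 2 + ℓ₁ + toℕ j

    bLeaf<N : ∀ j → bLeaf j < N
    bLeaf<N j = <-≤-trans (+-monoʳ-< (2 + ℓ₁) (toℕ<n j)) (≤-reflexive (2+ℓ₁+ℓ₂≡N ℓ₁ ℓ₂))

    ℓ₂≤count-B : ℓ₂ ≤ count InB? E
    ℓ₂≤count-B = injective⇒≤count InB? bLeaf (toℕ-injective ∘ +-cancelˡ-≡ (2 + ℓ₁) _ _)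
      (λ j → leaf-endpoint (≤-trans (m≤m+n 2 ℓ₁) (m≤m+n _ (toℕ j))) (bLeaf<N j))
      (λ j → m≤m+n (2 + ℓ₁) (toℕ j))

  handshake : count InA? E + (count (_<? 2) E + ℓ₂) ≤ length F + length F
  handshake = begin
    count InA? E + (count (_<? 2) E + ℓ₂)  ≤⟨ +-monoʳ-≤ (count InA? E) count-centres+ℓ₂≤count-notA ⟩
    count InA? E + count NotA? E           ≤⟨ count-+-≤ InA? NotA? (λ _ → yes tt) (λ a ¬a → ¬a a) _ _ E ⟩
    count (λ _ → yes tt) E                 ≤⟨ length-filter (λ _ → yes tt) E ⟩
    length E                               ≡⟨ length-endpoints F ⟩
    length F + length F                    ∎
    where open ≤-Reasoning

  size-≥ : ℓ₁ + ℓ₂ ≤ length F + length F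
  size-≥ = ≤-trans (+-mono-≤ ℓ₁≤count-A (m≤n+m ℓ₂ _)) handshake

  -- y is a leaf of c₂, so if x lay in no other pair its only neighbours c₁ and y would be non-adjacent.
  cross-pair⇒repeated : ¬ Any (_< 2) E → ∀ {x y} → Linked F x y → InA (toℕ x) → ¬ InA (toℕ y) →
                        2 ≤ occurrences (toℕ x) E
  cross-pair⇒repeated no-centre {x} {y} xy (2≤x , x<2+ℓ₁) y∉A with 2 ≤? occurrences (toℕ x) E
  ... | yes twice = twice
  ... | no ¬twice = ⊥-elim (no-triangle (proj₂ completion x))
    where
    once : occurrences (toℕ x) E ≤ 1
    once = ≤-pred (≰⇒> ¬twice)

    y-in-B : 2 + ℓ₁ ≤ toℕ y
    y-in-B = ≮⇒≥ λ y<2+ℓ₁ → y∉A (≮⇒≥ (no-centre ∘ lose (linked-endpoint (Sum.swap xy))) , y<2+ℓ₁)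

    neighbour : ∀ {z} → H x z → toℕ z ≡ 0 ⊎ z ≡ y
    neighbour xz with leaf-neighbour 2≤x xz
    ... | inj₁ e = inj₁ (DSEdge-centre-unique e (leaf₁ 2≤x x<2+ℓ₁))
    ... | inj₂ l = inj₂ (sym (linked-unique once xy l))

    c₁≁y : ∀ {c} → toℕ c ≡ 0 → ¬ H c y
    c₁≁y c≡0 (inj₁ (inj₁ e)) = <⇒≱ (DSEdge-0-< (subst (λ i → DSEdge ℓ₁ i _) c≡0 e)) y-in-B
    c₁≁y c≡0 (inj₁ (inj₂ e)) = n≮0 (subst (_ <_) c≡0 (DSEdge-< e))
    c₁≁y c≡0 (inj₂ l)        =
      no-centre (lose (linked-endpoint l) (subst (_< 2) (sym c≡0) (s≤s z≤n)))

    no-triangle : ¬ InTriangle H x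
    no-triangle (u , w , xu , uw , xw) with neighbour xu | neighbour xw
    ... | inj₁ u≡0  | inj₁ w≡0  = H-irrefl uw (trans u≡0 (sym w≡0))
    ... | inj₂ refl | inj₂ refl = H-irrefl uw refl
    ... | inj₁ u≡0  | inj₂ refl = c₁≁y u≡0 uw
    ... | inj₂ refl | inj₁ w≡0  = c₁≁y w≡0 (H-sym uw)

  odd⇒extra-endpoint : ℓ₁ % 2 ≡ 1 → ℓ₁ < count InA? E ⊎ 1 ≤ count (_<? 2) E
  odd⇒extra-endpoint ℓ₁-odd with any? (_<? 2) E
  ... | yes centre = inj₂ (filter-some (_<? 2) centre)
  ... | no no-centre with any? (straddles? InA?) F
  ...   | yes straddle with find straddle
  ...     | _ , uv , inj₁ (u∈A , v∉A) =
    inj₁ (repeated⇒ℓ₁<count-A u∈A (cross-pair⇒repeated no-centre (inj₁ uv) u∈A v∉A))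
  ...     | _ , vu , inj₂ (u∉A , v∈A) =
    inj₁ (repeated⇒ℓ₁<count-A v∈A (cross-pair⇒repeated no-centre (inj₂ vu) v∈A u∉A))
  odd⇒extra-endpoint ℓ₁-odd | no _ | no ¬straddle = inj₁ (≤∧≢⇒< ℓ₁≤count-A ℓ₁≢count-A)
    where
    ℓ₁≢count-A : ℓ₁ ≢ count InA? E
    ℓ₁≢count-A eq = 0≢1+n (begin
      0                 ≡⟨ n∣m⇒m%n≡0 _ 2 (even-count-endpoints InA? (All.¬Any⇒All¬ F ¬straddle)) ⟨
      count InA? E % 2  ≡⟨ cong (_% 2) eq ⟨
      ℓ₁ % 2            ≡⟨ ℓ₁-odd ⟩
      1                 ∎)
      where open ≡-Reasoning

  size->-of-odd : ℓ₁ % 2 ≡ 1 → ℓ₁ + ℓ₂ < length F + length F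
  size->-of-odd ℓ₁-odd with odd⇒extra-endpoint ℓ₁-odd
  ... | inj₁ ℓ₁<count-A = ≤-trans (+-mono-≤ ℓ₁<count-A (m≤n+m ℓ₂ _)) handshake
  ... | inj₂ centre     = ≤-trans (≤-reflexive (sym (+-suc ℓ₁ ℓ₂)))
                            (≤-trans (+-mono-≤ ℓ₁≤count-A (+-monoˡ-≤ ℓ₂ centre)) handshake)

module Construction (ℓ₁ ℓ₂ : ℕ) where

  N : ℕ
  N = ℓ₁ + ℓ₂ + 2

  V : Set
  V = Fin N

  0<N : 0 < N
  0<N = <-≤-trans (s≤s z≤n) (m≤n+m 2 (ℓ₁ + ℓ₂))

  1<N : 1 < N
  1<N = ≤-trans (s≤s (s≤s z≤n)) (2+ℓ₁≤N ℓ₁ ℓ₂)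

  vertex : ℕ → V
  vertex x with x <? N
  ... | yes x<N = fromℕ< x<N
  ... | no _    = fromℕ< 0<N

  toℕ-vertex : ∀ {x} → x < N → toℕ (vertex x) ≡ x
  toℕ-vertex {x} x<N with x <? N
  ... | yes _  = toℕ-fromℕ< _
  ... | no x≮N = ⊥-elim (x≮N x<N)

  vertex-toℕ : ∀ v → vertex (toℕ v) ≡ v
  vertex-toℕ v = toℕ-injective (toℕ-vertex (toℕ<n v))

  matching : (c s ℓ : ℕ) → List (V × V)
  matching c s 0             = []
  matching c s 1             = (vertex c , vertex s) ∷ []
  matching c s (suc (suc ℓ)) = (vertex s , vertex (suc s)) ∷ matching c (2 + s) ℓ

  length-matching : ∀ c s ℓ → length (matching c s ℓ) ≡ ⌈ ℓ /2⌉
  length-matching c s 0             = refl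
  length-matching c s 1             = refl
  length-matching c s (suc (suc ℓ)) = cong suc (length-matching c (2 + s) ℓ)

  +-suc-suc : ∀ s ℓ → s + suc (suc ℓ) ≡ 2 + s + ℓ
  +-suc-suc s ℓ = trans (+-suc s (suc ℓ)) (cong suc (+-suc s ℓ))

  MatchedPair : (c s ℓ : ℕ) → V × V → Set
  MatchedPair c s ℓ (a , b) =
    s ≤ toℕ b × toℕ b < s + ℓ × (toℕ a ≡ c ⊎ (s ≤ toℕ a × suc (toℕ a) ≡ toℕ b))

  matching-matched : ∀ {c s} ℓ → c < s → s + ℓ ≤ N → All (MatchedPair c s ℓ) (matching c s ℓ)
  matching-matched 0 _ _ = []
  matching-matched {c} {s} 1 c<s s+1≤N = last ∷ []
    where
    s<N : s < N
    s<N = <-≤-trans (m<m+n s z<s) s+1≤N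
    last : MatchedPair c s 1 (vertex c , vertex s)
    last rewrite toℕ-vertex s<N | toℕ-vertex (<-trans c<s s<N) = ≤-refl , m<m+n s z<s , inj₁ refl
  matching-matched {c} {s} (suc (suc ℓ)) c<s s+ℓ≤N =
    first ∷ All.map widen (matching-matched ℓ c<2+s 2+s+ℓ≤N)
    where
    c<2+s : c < 2 + s
    c<2+s = <-≤-trans c<s (m≤n+m s 2)
    2+s+ℓ≤N : 2 + s + ℓ ≤ N
    2+s+ℓ≤N = subst (_≤ N) (+-suc-suc s ℓ) s+ℓ≤N
    1+s<s+ℓ : suc s < s + suc (suc ℓ)
    1+s<s+ℓ = subst (suc s <_) (sym (+-suc-suc s ℓ)) (s≤s (s≤s (m≤m+n s ℓ)))
    first : MatchedPair c s (suc (suc ℓ)) (vertex s , vertex (suc s))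
    first rewrite toℕ-vertex (<-≤-trans (<-trans (n<1+n s) 1+s<s+ℓ) s+ℓ≤N)
                | toℕ-vertex (<-≤-trans 1+s<s+ℓ s+ℓ≤N)
      = n≤1+n s , 1+s<s+ℓ , inj₂ (≤-refl , refl)
    widen : ∀ {p} → MatchedPair c (2 + s) ℓ p → MatchedPair c s (suc (suc ℓ)) p
    widen {a , b} (2+s≤b , b<2+s+ℓ , source) =
        ≤-trans (m≤n+m s 2) 2+s≤b
      , subst (toℕ b <_) (sym (+-suc-suc s ℓ)) b<2+s+ℓ
      , Sum.map₂ (Product.map₁ (≤-trans (m≤n+m s 2))) source

  matching-unique : ∀ {c s} ℓ → c < s → s + ℓ ≤ N → Unique (matching c s ℓ)
  matching-unique 0 _ _ = []
  matching-unique 1 _ _ = [] ∷ []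
  matching-unique {c} {s} (suc (suc ℓ)) c<s s+ℓ≤N =
    All.map first-new (matching-matched ℓ c<2+s 2+s+ℓ≤N) ∷ matching-unique ℓ c<2+s 2+s+ℓ≤N
    where
    c<2+s : c < 2 + s
    c<2+s = <-≤-trans c<s (m≤n+m s 2)
    2+s+ℓ≤N : 2 + s + ℓ ≤ N
    2+s+ℓ≤N = subst (_≤ N) (+-suc-suc s ℓ) s+ℓ≤N
    first-new : ∀ {p} → MatchedPair c (2 + s) ℓ p → (vertex s , vertex (suc s)) ≢ p
    first-new (2+s≤b , _) refl =
      1+n≰n (subst (2 + s ≤_) (toℕ-vertex (<-≤-trans (s≤s (m≤m+n (suc s) ℓ)) 2+s+ℓ≤N)) 2+s≤b)

  matching-partner : ∀ {c s} ℓ {x} → s ≤ x → x < s + ℓ →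
    ∃ λ y → Linked (matching c s ℓ) (vertex x) (vertex y) × (y ≡ c ⊎ s ≤ y × y < s + ℓ)
  matching-partner {s = s} 0 s≤x x<s+0 =
    ⊥-elim (<⇒≱ x<s+0 (≤-trans (≤-reflexive (+-identityʳ s)) s≤x))
  matching-partner {c} {s} 1 {x} s≤x x<s+1
    with ≤-antisym (m<1+n⇒m≤n (subst (x <_) (+-comm s 1) x<s+1)) s≤x
  ... | refl = c , inj₂ (here refl) , inj₁ refl
  matching-partner {c} {s} (suc (suc ℓ)) {x} s≤x x<s+ℓ with x ≟ s | x ≟ suc s
  ... | yes refl | _        = suc s , inj₁ (here refl) , inj₂ (n≤1+n s , 1+s<s+ℓ)
    where
    1+s<s+ℓ : suc s < s + suc (suc ℓ)
    1+s<s+ℓ = subst (suc s <_) (sym (+-suc-suc s ℓ)) (s≤s (s≤s (m≤m+n s ℓ)))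
  ... | no _     | yes refl = s , inj₂ (here refl) , inj₂ (≤-refl , <-trans (n<1+n s) x<s+ℓ)
  ... | no x≢s   | no x≢1+s
    with matching-partner ℓ (≤∧≢⇒< (≤∧≢⇒< s≤x (x≢s ∘ sym)) (x≢1+s ∘ sym))
                            (subst (x <_) (+-suc-suc s ℓ) x<s+ℓ)
  ...   | y , linked , range =
    y , Sum.map there there linked , Sum.map₂ widen range
    where
    widen : 2 + s ≤ y × y < 2 + s + ℓ → s ≤ y × y < s + suc (suc ℓ)
    widen (2+s≤y , y<2+s+ℓ) = ≤-trans (m≤n+m s 2) 2+s≤y , subst (y <_) (sym (+-suc-suc s ℓ)) y<2+s+ℓ

  module Star (H : Graph N) (H-sym : Symmetric H) {c d s ℓ : ℕ}
              (spoke : ∀ {x} → s ≤ x → x < s + ℓ → H (vertex d) (vertex x))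
              (bridge : H (vertex d) (vertex c))
              (matched : ∀ {a b} → (a , b) ∈ matching c s ℓ → H a b) where

    star-triangle : ∀ {x} → s ≤ x → x < s + ℓ →
                    ∃ λ z → H (vertex d) (vertex x) × H (vertex x) z × H (vertex d) z
    star-triangle s≤x x<s+ℓ with matching-partner ℓ s≤x x<s+ℓ
    ... | y , linked , range =
      vertex y , spoke s≤x x<s+ℓ , [ matched , H-sym ∘ matched ]′ linked
               , [ (λ { refl → bridge }) , (λ (s≤y , y<s+ℓ) → spoke s≤y y<s+ℓ) ]′ range

    leaf-in-triangle : ∀ {x} → s ≤ x → x < s + ℓ → InTriangle H (vertex x)
    leaf-in-triangle s≤x x<s+ℓ with star-triangle s≤x x<s+ℓ
    ... | z , dx , xz , dz = vertex d , z , H-sym dx , dz , xz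

    centre-in-triangle : 0 < ℓ → InTriangle H (vertex d)
    centre-in-triangle 0<ℓ with star-triangle ≤-refl (m<m+n s 0<ℓ)
    ... | z , dx , xz , dz = vertex s , z , dx , xz , dz

  G : Graph N
  G = DoubleStar ℓ₁ ℓ₂

  pairs : List (V × V)
  pairs = matching 1 2 ℓ₁ ++ matching 0 (2 + ℓ₁) ℓ₂

  H : Graph N
  H = G ⊕ pairs

  H-sym : Symmetric H
  H-sym = ⊕-sym DoubleStar-sym

  tree-edge : ∀ {i j} → DSEdge ℓ₁ i j → i < N → j < N → H (vertex i) (vertex j)
  tree-edge e i<N j<N =
    inj₁ (inj₁ (subst₂ (DSEdge ℓ₁) (sym (toℕ-vertex i<N)) (sym (toℕ-vertex j<N)) e))

  module StarA = Star H H-sym {c = 1} {d = 0} {s = 2} {ℓ = ℓ₁}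
    (λ 2≤x x<2+ℓ₁ → tree-edge (leaf₁ 2≤x x<2+ℓ₁) 0<N (<-≤-trans x<2+ℓ₁ (2+ℓ₁≤N ℓ₁ ℓ₂)))
    (tree-edge centres 0<N 1<N)
    (inj₂ ∘ inj₁ ∘ ∈-++⁺ˡ)

  module StarB = Star H H-sym {c = 0} {d = 1} {s = 2 + ℓ₁} {ℓ = ℓ₂}
    (λ 2+ℓ₁≤x x<2+ℓ₁+ℓ₂ →
       tree-edge (leaf₂ 2+ℓ₁≤x) 1<N (<-≤-trans x<2+ℓ₁+ℓ₂ (≤-reflexive (2+ℓ₁+ℓ₂≡N ℓ₁ ℓ₂))))
    (H-sym (tree-edge centres 0<N 1<N))
    (inj₂ ∘ inj₁ ∘ ∈-++⁺ʳ _)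

  in-triangle : 1 ≤ ℓ₁ → 1 ≤ ℓ₂ → ∀ x → x < N → InTriangle H (vertex x)
  in-triangle 1≤ℓ₁ _ 0 _ = StarA.centre-in-triangle 1≤ℓ₁
  in-triangle _ 1≤ℓ₂ 1 _ = StarB.centre-in-triangle 1≤ℓ₂
  in-triangle _ _ (suc (suc k)) x<N with k <? ℓ₁
  ... | yes k<ℓ₁ = StarA.leaf-in-triangle (s≤s (s≤s z≤n)) (s≤s (s≤s k<ℓ₁))
  ... | no k≮ℓ₁  = StarB.leaf-in-triangle (s≤s (s≤s (≮⇒≥ k≮ℓ₁)))
                     (subst (2 + k <_) (sym (2+ℓ₁+ℓ₂≡N ℓ₁ ℓ₂)) x<N)

  matching-nonEdges : ∀ {c s} ℓ → c < s → s + ℓ ≤ N → 2 ≤ s →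
                      (∀ {b} → s ≤ b → b < s + ℓ → ¬ DSEdge ℓ₁ c b) →
                      All (λ (u , v) → toℕ u < toℕ v × ¬ G u v) (matching c s ℓ)
  matching-nonEdges {c} {s} ℓ c<s s+ℓ≤N 2≤s c≁ = All.map nonEdge (matching-matched ℓ c<s s+ℓ≤N)
    where
    nonEdge : ∀ {a b} → MatchedPair c s ℓ (a , b) → toℕ a < toℕ b × ¬ G a b
    nonEdge {a} {b} (s≤b , b<s+ℓ , source) = a<b , [ forward , backward ]′
      where
      a<b : toℕ a < toℕ b
      a<b = [ (λ a≡c → subst (_< toℕ b) (sym a≡c) (<-≤-trans c<s s≤b))
            , (λ (_ , 1+a≡b) → ≤-reflexive 1+a≡b) ]′ source
      forward : ¬ DSEdge ℓ₁ (toℕ a) (toℕ b)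
      forward e = [ (λ a≡c → c≁ s≤b b<s+ℓ (subst (λ i → DSEdge ℓ₁ i (toℕ b)) a≡c e))
                  , (λ (s≤a , _) → <⇒≱ (DSEdge-from-centre e) (≤-trans 2≤s s≤a)) ]′ source
      backward : ¬ DSEdge ℓ₁ (toℕ b) (toℕ a)
      backward e = <⇒≱ (DSEdge-< e) (<⇒≤ a<b)

  pairs-nonEdgeSet : IsNonEdgeSet G pairs
  pairs-nonEdgeSet =
      Unique.++⁺ (matching-unique ℓ₁ 1<2 A-bound) (matching-unique ℓ₂ 0<2+ℓ₁ B-bound) disjoint
    , All.++⁺ (matching-nonEdges ℓ₁ 1<2 A-bound ≤-refl
                 (λ { _ b<2+ℓ₁ (leaf₂ 2+ℓ₁≤b) → <⇒≱ b<2+ℓ₁ 2+ℓ₁≤b }))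
              (matching-nonEdges ℓ₂ 0<2+ℓ₁ B-bound (m≤m+n 2 ℓ₁)
                 (λ 2+ℓ₁≤b _ e → <⇒≱ (DSEdge-0-< e) 2+ℓ₁≤b))
    where
    1<2 : 1 < 2
    1<2 = s≤s (s≤s z≤n)
    0<2+ℓ₁ : 0 < 2 + ℓ₁
    0<2+ℓ₁ = s≤s z≤n
    A-bound : 2 + ℓ₁ ≤ N
    A-bound = 2+ℓ₁≤N ℓ₁ ℓ₂
    B-bound : 2 + ℓ₁ + ℓ₂ ≤ N
    B-bound = ≤-reflexive (2+ℓ₁+ℓ₂≡N ℓ₁ ℓ₂)
    disjoint : Disjoint (matching 1 2 ℓ₁) (matching 0 (2 + ℓ₁) ℓ₂)
    disjoint (p∈A , p∈B) =
      <⇒≱ (proj₁ (proj₂ (All.lookup (matching-matched ℓ₁ 1<2 A-bound) p∈A)))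
          (proj₁ (All.lookup (matching-matched ℓ₂ 0<2+ℓ₁ B-bound) p∈B))

  doubleStar-completion : 1 ≤ ℓ₁ → 1 ≤ ℓ₂ →
                          Σ _ λ F → IsΔCompletion G F × length F ≡ ⌈ ℓ₁ /2⌉ + ⌈ ℓ₂ /2⌉
  doubleStar-completion 1≤ℓ₁ 1≤ℓ₂ = pairs , (pairs-nonEdgeSet , every-vertex) , length-pairs
    where
    every-vertex : ∀ v → InTriangle H v
    every-vertex v = subst (InTriangle H) (vertex-toℕ v) (in-triangle 1≤ℓ₁ 1≤ℓ₂ (toℕ v) (toℕ<n v))
    length-pairs : length pairs ≡ ⌈ ℓ₁ /2⌉ + ⌈ ℓ₂ /2⌉
    length-pairs = trans (length-++ (matching 1 2 ℓ₁))
                         (cong₂ _+_ (length-matching 1 2 ℓ₁) (length-matching 0 (2 + ℓ₁) ℓ₂))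

data Halving : ℕ → Set where
  even : ∀ h → Halving (h + h)
  odd  : ∀ h → Halving (suc (h + h))

halving : ∀ n → Halving n
halving zero = even 0
halving (suc n) with halving n
... | even h = odd h
... | odd h  = subst Halving (cong suc (+-suc h h)) (even (suc h))

even-%2 : ∀ h → (h + h) % 2 ≡ 0
even-%2 zero    = refl
even-%2 (suc h) = trans (cong (_% 2) (+-suc (suc h) h)) (even-%2 h)

odd-%2 : ∀ h → suc (h + h) % 2 ≡ 1
odd-%2 zero    = refl
odd-%2 (suc h) = trans (cong (λ k → suc k % 2) (+-suc (suc h) h)) (odd-%2 h)

⌈double+n/2⌉ : ∀ h n → ⌈ (h + h) + n /2⌉ ≡ h + ⌈ n /2⌉
⌈double+n/2⌉ zero    n = refl
⌈double+n/2⌉ (suc h) n rewrite +-suc h h = cong suc (⌈double+n/2⌉ h n)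

⌈n+2/2⌉ : ∀ n → ⌈ n + 2 /2⌉ ≡ suc ⌈ n /2⌉
⌈n+2/2⌉ n = cong ⌈_/2⌉ (+-comm n 2)

⌈/2⌉+⌈/2⌉-not-both-odd : ∀ a b → ¬ (a % 2 ≡ 1 × b % 2 ≡ 1) → ⌈ a /2⌉ + ⌈ b /2⌉ ≡ ⌈ a + b /2⌉
⌈/2⌉+⌈/2⌉-not-both-odd a b ¬both-odd with halving a | halving b
... | even h | _ = begin
  ⌈ h + h /2⌉ + ⌈ b /2⌉  ≡⟨ cong (_+ ⌈ b /2⌉) (n≡⌈n+n/2⌉ h) ⟨
  h + ⌈ b /2⌉            ≡⟨ ⌈double+n/2⌉ h b ⟨
  ⌈ (h + h) + b /2⌉      ∎
  where open ≡-Reasoning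
... | odd _  | even h = begin
  ⌈ a /2⌉ + ⌈ h + h /2⌉  ≡⟨ cong (⌈ a /2⌉ +_) (n≡⌈n+n/2⌉ h) ⟨
  ⌈ a /2⌉ + h            ≡⟨ +-comm ⌈ a /2⌉ h ⟩
  h + ⌈ a /2⌉            ≡⟨ ⌈double+n/2⌉ h a ⟨
  ⌈ (h + h) + a /2⌉      ≡⟨ cong ⌈_/2⌉ (+-comm (h + h) a) ⟩
  ⌈ a + (h + h) /2⌉      ∎
  where open ≡-Reasoning
... | odd h₁ | odd h₂ = ⊥-elim (¬both-odd (odd-%2 h₁ , odd-%2 h₂))

⌈/2⌉+⌈/2⌉-both-odd : ∀ a b → a % 2 ≡ 1 → b % 2 ≡ 1 →
                     ∃ λ t → a + b ≡ t + t × ⌈ a /2⌉ + ⌈ b /2⌉ ≡ suc t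
⌈/2⌉+⌈/2⌉-both-odd a b a-odd b-odd with halving a | halving b
... | even h | _      = ⊥-elim (0≢1+n (trans (sym (even-%2 h)) a-odd))
... | odd _  | even h = ⊥-elim (0≢1+n (trans (sym (even-%2 h)) b-odd))
... | odd h₁ | odd h₂ =
  suc (h₁ + h₂) , sum≡ h₁ h₂ , trans (cong₂ _+_ (⌈odd/2⌉ h₁) (⌈odd/2⌉ h₂)) (cong suc (+-suc h₁ h₂))
  where
  sum≡ : ∀ h₁ h₂ → suc (h₁ + h₁) + suc (h₂ + h₂) ≡ suc (h₁ + h₂) + suc (h₁ + h₂)
  sum≡ = solve-∀
  ⌈odd/2⌉ : ∀ h → ⌈ suc (h + h) /2⌉ ≡ suc h
  ⌈odd/2⌉ h = cong suc (sym (n≡⌊n+n/2⌋ h))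

⌈/2⌉+⌈/2⌉≡⌈a+b+2/2⌉ : ∀ a b → a % 2 ≡ 1 → b % 2 ≡ 1 → ⌈ a /2⌉ + ⌈ b /2⌉ ≡ ⌈ a + b + 2 /2⌉
⌈/2⌉+⌈/2⌉≡⌈a+b+2/2⌉ a b a-odd b-odd with ⌈/2⌉+⌈/2⌉-both-odd a b a-odd b-odd
... | t , a+b≡t+t , sum≡ = begin
  ⌈ a /2⌉ + ⌈ b /2⌉  ≡⟨ sum≡ ⟩
  suc t              ≡⟨ cong suc (n≡⌈n+n/2⌉ t) ⟩
  suc ⌈ t + t /2⌉    ≡⟨ cong (suc ∘ ⌈_/2⌉) a+b≡t+t ⟨
  suc ⌈ a + b /2⌉    ≡⟨ ⌈n+2/2⌉ (a + b) ⟨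
  ⌈ a + b + 2 /2⌉    ∎
  where open ≡-Reasoning

⌈/2⌉+⌈/2⌉≡⌈a+b+2/2⌉∸1 : ∀ a b → ¬ (a % 2 ≡ 1 × b % 2 ≡ 1) →
                        ⌈ a /2⌉ + ⌈ b /2⌉ ≡ ⌈ a + b + 2 /2⌉ ∸ 1
⌈/2⌉+⌈/2⌉≡⌈a+b+2/2⌉∸1 a b ¬both-odd =
  trans (⌈/2⌉+⌈/2⌉-not-both-odd a b ¬both-odd) (cong (_∸ 1) (sym (⌈n+2/2⌉ (a + b))))

⌈/2⌉-≤ : ∀ {n} m → n ≤ m + m → ⌈ n /2⌉ ≤ m
⌈/2⌉-≤ m n≤m+m = ≤-trans (⌈n/2⌉-mono n≤m+m) (≤-reflexive (sym (n≡⌈n+n/2⌉ m)))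

double-<⇒< : ∀ {t m} → t + t < m + m → t < m
double-<⇒< t+t<m+m = ≰⇒> λ m≤t → <⇒≱ t+t<m+m (+-mono-≤ m≤t m≤t)

⌈/2⌉+⌈/2⌉-≤ : ∀ a b m → a + b ≤ m + m → (a % 2 ≡ 1 → b % 2 ≡ 1 → a + b < m + m) →
              ⌈ a /2⌉ + ⌈ b /2⌉ ≤ m
⌈/2⌉+⌈/2⌉-≤ a b m a+b≤m+m both-odd⇒< with (a % 2 ≟ 1) ×-dec (b % 2 ≟ 1)
... | no ¬both-odd =
  subst (_≤ m) (sym (⌈/2⌉+⌈/2⌉-not-both-odd a b ¬both-odd)) (⌈/2⌉-≤ m a+b≤m+m)
... | yes (a-odd , b-odd) with ⌈/2⌉+⌈/2⌉-both-odd a b a-odd b-odd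
...   | t , a+b≡t+t , sum≡ =
  subst (_≤ m) (sym sum≡) (double-<⇒< (subst (_< m + m) a+b≡t+t (both-odd⇒< a-odd b-odd)))

completion-size-≥ : ∀ {ℓ₁ ℓ₂ F} → IsΔCompletion (DoubleStar ℓ₁ ℓ₂) F →
                    ⌈ ℓ₁ /2⌉ + ⌈ ℓ₂ /2⌉ ≤ length F
completion-size-≥ {ℓ₁} {ℓ₂} {F} completion =
  ⌈/2⌉+⌈/2⌉-≤ ℓ₁ ℓ₂ (length F) size-≥ (λ ℓ₁-odd _ → size->-of-odd ℓ₁-odd)
  where open LowerBound completion

doubleStar-Δ : ∀ ℓ₁ ℓ₂ → 1 ≤ ℓ₁ → 1 ≤ ℓ₂ → IsΔ (DoubleStar ℓ₁ ℓ₂) (⌈ ℓ₁ /2⌉ + ⌈ ℓ₂ /2⌉)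
doubleStar-Δ ℓ₁ ℓ₂ 1≤ℓ₁ 1≤ℓ₂ =
  Construction.doubleStar-completion ℓ₁ ℓ₂ 1≤ℓ₁ 1≤ℓ₂ , λ _ → completion-size-≥

proposition6p2 : (ℓ₁ ℓ₂ : ℕ) → 1 ≤ ℓ₁ → 1 ≤ ℓ₂ →
    ((ℓ₁ % 2 ≡ 1 × ℓ₂ % 2 ≡ 1) →
      IsΔ (DoubleStar ℓ₁ ℓ₂) ⌈ ℓ₁ + ℓ₂ + 2 /2⌉)
    × (¬ (ℓ₁ % 2 ≡ 1 × ℓ₂ % 2 ≡ 1) →
      IsΔ (DoubleStar ℓ₁ ℓ₂) (⌈ ℓ₁ + ℓ₂ + 2 /2⌉ ∸ 1))
proposition6p2 ℓ₁ ℓ₂ 1≤ℓ₁ 1≤ℓ₂ =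
    (λ (ℓ₁-odd , ℓ₂-odd) → subst (IsΔ (DoubleStar ℓ₁ ℓ₂)) (⌈/2⌉+⌈/2⌉≡⌈a+b+2/2⌉ ℓ₁ ℓ₂ ℓ₁-odd ℓ₂-odd) Δ)
  , (λ ¬both-odd → subst (IsΔ (DoubleStar ℓ₁ ℓ₂)) (⌈/2⌉+⌈/2⌉≡⌈a+b+2/2⌉∸1 ℓ₁ ℓ₂ ¬both-odd) Δ)
  where
  Δ : IsΔ (DoubleStar ℓ₁ ℓ₂) (⌈ ℓ₁ /2⌉ + ⌈ ℓ₂ /2⌉)
  Δ = doubleStar-Δ ℓ₁ ℓ₂ 1≤ℓ₁ 1≤ℓ₂
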